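{- For every $n\ge 1$, $\eta(K_n)=n$.
   Context: $K_n$ is the complete graph on $n$ vertices. A configuration $C$ on $G$ is a function $C:V(G)\to\mathbb{Z}_{\ge 0}$; its size is $\sum_v C(v)$. A pebbling move removes two pebbles from a vertex and places one pebble on an adjacent vertex. The Two-Player Pebbling Game on $G$ with root $r$ and starting configuration $C$ is played by Mover and Defender in rounds: in each round Mover makes a pebbling move and then Defender makes a pebbling move; each player must take their turn. If Mover pebbles from $u$ to $v$, Defender may not pebble from $v$ to $u$ in the same round. Mover wins if at any time the root has at least one pebble; Defender wins if the root has no pebble and there are no more pebbling moves. A winning strategy is a rule choosing a player's moves as a function of the current position which guarantees that player wins. $\eta(G,r)$ is the minimum $m$ such that for every configuration of $m$ pebbles Mover has a winning strategy; if for arbitrarily large $m$ there is a configuration of size greater than $m$ on which Defender has a winning strategy, then $\eta(G,r)=\infty$. $\eta(G)=\max_{r\in V(G)}\eta(G,r)$. -}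

module Defs where

open import Data.Nat using (ℕ; zero; suc; _∸_; _≤_; _<_)
open import Data.Fin using (Fin; _≟_)
open import Data.List using (map; allFin)
open import Data.Nat.ListAction using (sum)
open import Data.Product using (Σ; _×_)
open import Data.Sum using (_⊎_)
open import Data.Bool using (if_then_else_)
open import Relation.Nullary using (¬_; does)
open import Relation.Binary.PropositionalEquality using (_≡_; _≢_)

Adjacency : ℕ → Set₁
Adjacency n = Fin n → Fin n → Set

K : (n : ℕ) → Adjacency n
K n u v = u ≢ v

Config : ℕ → Set
Config n = Fin n → ℕ

size : ∀ {n} → Config n → ℕ
size {n} C = sum (map C (allFin n))

remove2 : ∀ {n} → Config n → Fin n → Config n
remove2 C u w = if does (w ≟ u) then C w ∸ 2 else C w

add1 : ∀ {n} → Config n → Fin n → Config n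
add1 C v w = if does (w ≟ v) then suc (C w) else C w

move : ∀ {n} → Config n → Fin n → Fin n → Config n
move C u v = add1 (remove2 C u) v

CanMove : ∀ {n} → Adjacency n → Config n → Fin n → Fin n → Set
CanMove G C u v = G u v × 2 ≤ C u

NoMoves : ∀ {n} → Adjacency n → Config n → Set
NoMoves G C = ∀ u v → ¬ CanMove G C u v

module Game {n : ℕ} (G : Adjacency n) (r : Fin n) where

  mutual
    data MoverWins (C : Config n) : Set where
      root-reached : 1 ≤ C r → MoverWins C
      mover-plays  : ∀ u v → CanMove G C u v →
                     MoverWinsAfter (move C u v) u v → MoverWins C

    -- Defender is to move in C, Mover having just pebbled u → v;
    -- Mover has a winning strategy from here.
    data MoverWinsAfter (C : Config n) (u v : Fin n) : Set where
      root-reached : 1 ≤ C r → MoverWinsAfter C u v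
      defender-any : (Σ (Fin n) λ w → Σ (Fin n) λ z → CanMove G C w z) →
                     (∀ w z → CanMove G C w z → ¬ (w ≡ v × z ≡ u) →
                        MoverWins (move C w z)) →
                     MoverWinsAfter C u v

  mutual
    data DefenderWins (C : Config n) : Set where
      defender-holds : C r ≡ 0 →
                       (∀ u v → CanMove G C u v →
                          DefenderWinsAfter (move C u v) u v) →
                       DefenderWins C

    -- Defender has a winning strategy, Defender to move in C after
    -- Mover pebbled u → v.
    data DefenderWinsAfter (C : Config n) (u v : Fin n) : Set where
      game-over     : C r ≡ 0 → NoMoves G C → DefenderWinsAfter C u v
      defender-plays : C r ≡ 0 → ∀ w z → CanMove G C w z → ¬ (w ≡ v × z ≡ u) →
                       DefenderWins (move C w z) → DefenderWinsAfter C u v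

  EtaRootInfinite : Set
  EtaRootInfinite = ∀ m → Σ (Config n) λ C → m < size C × DefenderWins C

  EtaRootIs : ℕ → Set
  EtaRootIs k =
    (∀ (C : Config n) → size C ≡ k → MoverWins C) ×
    (∀ m → m < k → Σ (Config n) λ C → size C ≡ m × ¬ MoverWins C) ×
    ¬ EtaRootInfinite

EtaIs : ∀ {n} → Adjacency n → ℕ → Set
EtaIs {n} G k =
  (∀ r → Σ ℕ λ j → j ≤ k × Game.EtaRootIs G r j) ×
  Σ (Fin n) λ r → Game.EtaRootIs G r k

module Submission where

-- Call a configuration *flat* if every vertex carries at most one pebble;
-- on a flat configuration no pebbling move is possible.  Fix a root r of
-- K_(n+1).  Upper bound: if Mover faces at least n+1 pebbles, either some
-- vertex u holds two pebbles (then r is reached at once, either because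
-- u = r or by pebbling u → r, which is legal in a complete graph), or the
-- configuration is flat, and a flat configuration with an empty root has
-- at most n pebbles, so the root is already occupied.  Lower bound: for
-- every m ≤ n there is a flat configuration of size m with an empty root;
-- it is a dead position, so Mover cannot win.  Finally η(K_(n+1), r) is not
-- infinite because Mover and Defender cannot both have winning strategies.

open import Defs
open import Data.Nat using (ℕ; zero; suc; _≤_; z≤n; s≤s; _≤?_)
open import Data.Nat.Properties
  using (≤-refl; ≤-trans; ≤-reflexive; +-mono-≤; n≤1+n; <⇒≤; ≤-pred; ≰⇒>; n≢0⇒n>0; 1+n≰n; ≤⇒≯)
import Data.Nat as ℕ
open import Data.Fin using (Fin; _≟_)
import Data.Fin as Fin
open import Data.Fin.Properties using (any?)
open import Data.Vec.Functional using (_∷_; tail)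
open import Data.List using (tabulate)
open import Data.List.Properties using (map-tabulate)
open import Data.Nat.ListAction using (sum)
open import Data.Product using (Σ; _×_; _,_)
open import Data.Sum using (_⊎_; inj₁; inj₂)
open import Data.Empty using (⊥; ⊥-elim)
open import Relation.Nullary using (¬_; yes; no)
open import Relation.Binary.PropositionalEquality
  using (_≡_; refl; sym; trans; cong; subst)

-- The size of a configuration as a sum over `tabulate`, which unfolds
-- definitionally along the first vertex: total (x ∷ C) = x + total C.
total : ∀ {n} → Config n → ℕ
total C = sum (tabulate C)

size≡total : ∀ {n} (C : Config n) → size C ≡ total C
size≡total C = cong sum (map-tabulate (λ u → u) C)

Flat : ∀ {n} → Config n → Set
Flat C = ∀ u → C u ≤ 1

flat-∷ : ∀ {n} {x} {C : Config n} → x ≤ 1 → Flat C → Flat (x ∷ C)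
flat-∷ x≤1 flat Fin.zero    = x≤1
flat-∷ x≤1 flat (Fin.suc u) = flat u

flat-total-≤ : ∀ {n} (C : Config n) → Flat C → total C ≤ n
flat-total-≤ {zero}  C flat = z≤n
flat-total-≤ {suc n} C flat =
  +-mono-≤ (flat Fin.zero) (flat-total-≤ (tail C) (λ u → flat (Fin.suc u)))

flat-empty-total-≤ : ∀ {n} (C : Config (suc n)) (r : Fin (suc n)) →
                     C r ≡ 0 → Flat C → total C ≤ n
flat-empty-total-≤ C Fin.zero Cr≡0 flat rewrite Cr≡0 =
  flat-total-≤ (tail C) (λ u → flat (Fin.suc u))
flat-empty-total-≤ {suc n} C (Fin.suc r) Cr≡0 flat =
  +-mono-≤ (flat Fin.zero)
           (flat-empty-total-≤ (tail C) r Cr≡0 (λ u → flat (Fin.suc u)))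

flat-of-size : ∀ n m → m ≤ n → Σ (Config n) λ C → Flat C × total C ≡ m
flat-of-size zero    zero    z≤n     = (λ ()) , (λ ()) , refl
flat-of-size (suc n) zero    z≤n     with flat-of-size n zero z≤n
... | C , flat , total≡ = 0 ∷ C , flat-∷ z≤n flat , total≡
flat-of-size (suc n) (suc m) (s≤s m≤n) with flat-of-size n m m≤n
... | C , flat , total≡ = 1 ∷ C , flat-∷ ≤-refl flat , cong suc total≡

flat-avoiding : ∀ n m → m ≤ n → (r : Fin (suc n)) →
                Σ (Config (suc n)) λ C → C r ≡ 0 × Flat C × total C ≡ m
flat-avoiding n m m≤n Fin.zero with flat-of-size n m m≤n
... | C , flat , total≡ = 0 ∷ C , refl , flat-∷ z≤n flat , total≡
flat-avoiding (suc n) zero z≤n (Fin.suc r) with flat-avoiding n zero z≤n r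
... | C , Cr≡0 , flat , total≡ = 0 ∷ C , Cr≡0 , flat-∷ z≤n flat , total≡
flat-avoiding (suc n) (suc m) (s≤s m≤n) (Fin.suc r) with flat-avoiding n m m≤n r
... | C , Cr≡0 , flat , total≡ = 1 ∷ C , Cr≡0 , flat-∷ ≤-refl flat , cong suc total≡

heavy-or-flat : ∀ {n} (C : Config n) → (Σ (Fin n) λ u → 2 ≤ C u) ⊎ Flat C
heavy-or-flat C with any? (λ u → 2 ≤? C u)
... | yes heavy = inj₁ heavy
... | no ¬heavy = inj₂ λ u → ≤-pred (≰⇒> (λ 2≤Cu → ¬heavy (u , 2≤Cu)))

add1-occupies : ∀ {n} (C : Config n) (v : Fin n) → 1 ≤ add1 C v v
add1-occupies C v with v ≟ v
... | yes _   = s≤s z≤n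
... | no v≢v = ⊥-elim (v≢v refl)

flat⇒no-moves : ∀ {n} (G : Adjacency n) {C : Config n} → Flat C → NoMoves G C
flat⇒no-moves G flat u v (_ , 2≤Cu) with ≤-trans 2≤Cu (flat u)
... | s≤s ()

empty-unoccupied : ∀ {k} → k ≡ 0 → ¬ 1 ≤ k
empty-unoccupied refl = 1+n≰n

module _ {n : ℕ} (G : Adjacency n) (r : Fin n) where
  open Game G r

  dead-position : ∀ {C : Config n} → C r ≡ 0 → NoMoves G C → ¬ MoverWins C
  dead-position Cr≡0 _     (root-reached 1≤Cr)       = empty-unoccupied Cr≡0 1≤Cr
  dead-position _    stuck (mover-plays u v canMove _) = stuck u v canMove

  -- Mover and Defender cannot both have winning strategies: play one
  -- against the other until one of them is contradicted.
  wins-exclusive : ∀ {C : Config n} → MoverWins C → DefenderWins C → ⊥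
  wins-exclusive (root-reached 1≤Cr) (defender-holds Cr≡0 _) = empty-unoccupied Cr≡0 1≤Cr
  wins-exclusive (mover-plays u v canMove after) (defender-holds _ reply) =
    after-exclusive after (reply u v canMove)
    where
    after-exclusive : ∀ {C u v} → MoverWinsAfter C u v → DefenderWinsAfter C u v → ⊥
    after-exclusive (root-reached 1≤Cr) (game-over Cr≡0 _) = empty-unoccupied Cr≡0 1≤Cr
    after-exclusive (root-reached 1≤Cr) (defender-plays Cr≡0 _ _ _ _ _) = empty-unoccupied Cr≡0 1≤Cr
    after-exclusive (defender-any (w , z , canMove) _) (game-over _ stuck) = stuck w z canMove
    after-exclusive (defender-any _ answer) (defender-plays _ w z canMove legal next) =
      wins-exclusive (answer w z canMove legal) next

  eventually-winning⇒finite : ∀ k → (∀ C → k ≤ size C → MoverWins C) → ¬ EtaRootInfinite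
  eventually-winning⇒finite k wins large with large k
  ... | C , k<size , defenderWins = wins-exclusive (wins C (<⇒≤ k<size)) defenderWins

complete-mover-wins : ∀ n (r : Fin (suc n)) (C : Config (suc n)) →
                      suc n ≤ size C → Game.MoverWins (K (suc n)) r C
complete-mover-wins n r C n<size with heavy-or-flat C
... | inj₁ (u , 2≤Cu) with u ≟ r
...   | yes refl = Game.root-reached (≤-trans (n≤1+n 1) 2≤Cu)
...   | no u≢r   = Game.mover-plays u r (u≢r , 2≤Cu)
                     (Game.root-reached (add1-occupies (remove2 C u) r))
complete-mover-wins n r C n<size | inj₂ flat with C r ℕ.≟ 0
... | no Cr≢0  = Game.root-reached (n≢0⇒n>0 Cr≢0)
... | yes Cr≡0 = ⊥-elim (≤⇒≯ (flat-empty-total-≤ C r Cr≡0 flat)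
                              (subst (suc n ≤_) (size≡total C) n<size))

eta-complete-root : ∀ n (r : Fin (suc n)) → Game.EtaRootIs (K (suc n)) r (suc n)
eta-complete-root n r =
    (λ C size≡ → wins C (≤-reflexive (sym size≡)))
  , (λ m m<n+1 →
       let (C , Cr≡0 , flat , total≡) = flat-avoiding n m (≤-pred m<n+1) r
       in  C , trans (size≡total C) total≡
             , dead-position (K (suc n)) r Cr≡0 (flat⇒no-moves (K (suc n)) flat))
  , eventually-winning⇒finite (K (suc n)) r (suc n) wins
  where
  wins : ∀ C → suc n ≤ size C → Game.MoverWins (K (suc n)) r C
  wins = complete-mover-wins n r

corollary2p3 : ∀ (n : ℕ) → 1 ≤ n → EtaIs (K n) n
corollary2p3 (suc n) _ =
  (λ r → suc n , ≤-refl , eta-complete-root n r) , (Fin.zero , eta-complete-root n Fin.zero)
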